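{- There is no Lyndon-like family $\{(X_n,C_n,f_n(q))\}_{n\ge1}$ of instances of the cyclic sieving phenomenon with $|X_n|=\frac{1}{n+1}\binom{2n}{n}$ (the $n$-th Catalan number) for all $n\ge1$.
   Context: A triple $(X,C_n,f(q))$, $C_n=\langle g\rangle$ cyclic of order $n$ acting on the finite set $X$, $f$ a polynomial with non-negative integer coefficients, exhibits the cyclic sieving phenomenon if $f(\omega_n^k)=|\{x\in X: g^k\cdot x=x\}|$ for all $k\in\{1,\dots,n\}$, $\omega_n=e^{2\pi i/n}$. A family $\{(X_n,C_n,f_n(q))\}_{n\ge1}$ of such instances, with $C_n$ cyclic of order $n$, is Lyndon-like if $f_{n/m}(1)=f_n(e^{2\pi i/m})$ whenever $m\mid n$. -}

module Defs where

open import Level using (_⊔_)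
open import Data.Nat.Base as ℕ using (ℕ; zero; suc; _≤_; _<_; _/_)
open import Data.Nat.Divisibility using (_∣_)
open import Data.Nat.Combinatorics using (_C_)
open import Data.Fin.Base using (Fin)
open import Data.Fin.Properties using (_≟_)
open import Data.List.Base using (List; []; _∷_; length; filter; allFin)
open import Data.Product.Base using (_×_)
import Data.Sum
open import Relation.Binary.PropositionalEquality using (_≡_)
open import Relation.Nullary.Negation using (¬_)
open import Algebra.Bundles using (CommutativeRing)

catalan : ℕ → ℕ
catalan n = ((2 ℕ.* n) C n) / suc n

iter : ∀ {a} {A : Set a} → (A → A) → ℕ → A → A
iter g zero    x = x
iter g (suc k) x = g (iter g k x)

fixCount : (N : ℕ) → (Fin N → Fin N) → ℕ
fixCount N h = length (filter (λ x → h x ≟ x) (allFin N))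

module _ {c ℓ} (R : CommutativeRing c ℓ) where
  open CommutativeRing R

  fromℕ : ℕ → Carrier
  fromℕ zero    = 0#
  fromℕ (suc m) = 1# + fromℕ m

  pow : Carrier → ℕ → Carrier
  pow x zero    = 1#
  pow x (suc k) = x * pow x k

  -- a polynomial with non-negative integer coefficients,
  -- given as its coefficient list [a₀, a₁, a₂, …], evaluated at x (Horner)
  eval : List ℕ → Carrier → Carrier
  eval []       x = 0#
  eval (a ∷ as) x = fromℕ a + x * eval as x

  record IsChar0Domain : Set (c ⊔ ℓ) where
    field
      1≉0          : ¬ (1# ≈ 0#)
      noZeroDivisors : ∀ x y → x * y ≈ 0# → (x ≈ 0#) Data.Sum.⊎ (y ≈ 0#)
      char0        : ∀ m → ¬ (fromℕ (suc m) ≈ 0#)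

  IsPrimitiveRoot : ℕ → Carrier → Set ℓ
  IsPrimitiveRoot n ω = (pow ω n ≈ 1#) × (∀ k → 1 ≤ k → k < n → ¬ (pow ω k ≈ 1#))

  -- A family {(X_n, C_n, f_n(q))}_{n ≥ 1}:  X_n = Fin (size n), the cyclic group
  -- C_n = ⟨g⟩ of order n acts through the map  act n  (the action of g), so that
  -- g^n acts trivially;  f_n  is a polynomial with coefficients in ℕ.
  -- The roots of unity ω_n = e^{2πi/n} are modelled by  ω n  in R.
  -- Values at n = 0 are irrelevant junk.
  record CSPFamily (ω : ℕ → Carrier) : Set ℓ where
    field
      size : ℕ → ℕ
      act  : (n : ℕ) → Fin (size n) → Fin (size n)
      poly : ℕ → List ℕ
      actOrder : ∀ n → 1 ≤ n → ∀ x → iter (act n) n x ≡ x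
      sieving  : ∀ n → 1 ≤ n → ∀ k → 1 ≤ k → k ≤ n →
                 eval (poly n) (pow (ω n) k) ≈ fromℕ (fixCount (size n) (iter (act n) k))

  -- Lyndon-like: f_{n/m}(1) = f_n(e^{2πi/m}) whenever m ∣ n,
  -- where e^{2πi/m} = ω_n^{n/m}
  LyndonLike : {ω : ℕ → Carrier} → CSPFamily ω → Set ℓ
  LyndonLike {ω} F = ∀ n m → 1 ≤ n → (m∣n : m ∣ n) →
      eval (poly (quotient m∣n)) 1# ≈ eval (poly n) (pow (ω n) (quotient m∣n))
    where open CSPFamily F
          open Data.Nat.Divisibility using (quotient)

-- Two general facts about a CSP family {(X_n, C_n = ⟨g⟩, f_n)} are proved first.
-- (1) f_n(1) = |X_n|: evaluate the sieving identity at k = n, where ω_n^n = 1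
--     and g^n is the identity, which fixes every point.
-- (2) If the family is Lyndon-like, then g has exactly |X_1| fixed points on
--     every X_n: taking m = n in the Lyndon-like condition gives
--     f_1(1) = f_n(ω_n), and then (1) and sieving at k = 1 apply.
-- Since R has characteristic zero, the map ℕ → R is injective, so (2) holds
-- as an equation of natural numbers.  For the Catalan family |X_1| = 1 and
-- |X_2| = 2; but the generator of C_2 is an involution of a two-element set,
-- which fixes either no point or both, never exactly one.
module Submission where

open import Defs
open import Data.Nat.Base using (ℕ; zero; suc; _≤_; s≤s; z≤n)
open import Data.Nat.Properties using (≤-refl)
open import Data.Nat.Divisibility using (∣-refl)
open import Data.Product.Base using (Σ; _×_; _,_; proj₁)
open import Data.Fin.Base using (Fin; zero; suc)
open import Data.Fin.Properties using (_≟_)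
open import Data.List.Base using ([]; _∷_; length; allFin)
open import Data.List.Properties using (filter-all; length-tabulate)
open import Data.List.Relation.Unary.All using (universal)
open import Relation.Binary.PropositionalEquality
  using (_≡_; _≢_; refl; sym; trans; cong; module ≡-Reasoning)
open import Relation.Nullary using (yes; no)
open import Relation.Nullary.Negation using (¬_; contradiction)
open import Algebra.Bundles using (CommutativeRing)
import Relation.Binary.Reasoning.Setoid as SetoidReasoning

fixCount-identity : ∀ N (h : Fin N → Fin N) → (∀ x → h x ≡ x) → fixCount N h ≡ N
fixCount-identity N h fixed = trans
  (cong length (filter-all (λ x → h x ≟ x) (universal fixed (allFin N))))
  (length-tabulate (λ x → x))

other-of-two₀ : {x : Fin 2} → x ≢ zero → x ≡ suc zero
other-of-two₀ {zero}     x≢0 = contradiction refl x≢0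
other-of-two₀ {suc zero} x≢0 = refl

other-of-two₁ : {x : Fin 2} → x ≢ suc zero → x ≡ zero
other-of-two₁ {zero}     x≢1 = refl
other-of-two₁ {suc zero} x≢1 = contradiction refl x≢1

-- An involution of a two-element set fixes no point or both points:
-- if it fixed only one of them it would map the other one onto it as well.
involution-fixCount≢1 : ∀ N (h : Fin N → Fin N) → (∀ x → h (h x) ≡ x) →
                        N ≡ 2 → fixCount N h ≢ 1
involution-fixCount≢1 .2 h invol refl with h zero ≟ zero
... | yes h0≡0 with h (suc zero) ≟ suc zero
...   | yes _    = λ ()
...   | no h1≢1 with () ← trans (sym (invol (suc zero)))
                               (trans (cong h (other-of-two₁ h1≢1)) h0≡0)
involution-fixCount≢1 .2 h invol refl | no h0≢0 with h (suc zero) ≟ suc zero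
...   | no _     = λ ()
...   | yes h1≡1 with () ← trans (sym (invol zero))
                               (trans (cong h (other-of-two₀ h0≢0)) h1≡1)

module _ {c ℓ} (R : CommutativeRing c ℓ) where
  open CommutativeRing R renaming (refl to ≈-refl; sym to ≈-sym)
  open SetoidReasoning setoid

  eval-cong : ∀ as {x y} → x ≈ y → eval R as x ≈ eval R as y
  eval-cong []       x≈y = ≈-refl
  eval-cong (a ∷ as) x≈y = +-cong ≈-refl (*-cong x≈y (eval-cong as x≈y))

  +-cancel-1# : ∀ {a b} → 1# + a ≈ 1# + b → a ≈ b
  +-cancel-1# {a} {b} 1+a≈1+b = begin
    a                 ≈⟨ ≈-sym (+-identityˡ a) ⟩
    0# + a            ≈⟨ +-congʳ (≈-sym (-‿inverseˡ 1#)) ⟩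
    (- 1# + 1#) + a   ≈⟨ +-assoc _ _ _ ⟩
    - 1# + (1# + a)   ≈⟨ +-congˡ 1+a≈1+b ⟩
    - 1# + (1# + b)   ≈⟨ ≈-sym (+-assoc _ _ _) ⟩
    (- 1# + 1#) + b   ≈⟨ +-congʳ (-‿inverseˡ 1#) ⟩
    0# + b            ≈⟨ +-identityˡ b ⟩
    b                 ∎

  fromℕ-injective : IsChar0Domain R → ∀ m n → fromℕ R m ≈ fromℕ R n → m ≡ n
  fromℕ-injective dom zero    zero    _ = refl
  fromℕ-injective dom zero    (suc n) e = contradiction (≈-sym e) (IsChar0Domain.char0 dom n)
  fromℕ-injective dom (suc m) zero    e = contradiction e (IsChar0Domain.char0 dom m)
  fromℕ-injective dom (suc m) (suc n) e =
    cong suc (fromℕ-injective dom m n (+-cancel-1# e))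

  module _ {ω : ℕ → Carrier} (prim : ∀ n → 1 ≤ n → IsPrimitiveRoot R n (ω n))
           (F : CSPFamily R ω) where
    open CSPFamily F

    -- f_n(1) = |X_n|: sieving at k = n, where g^n acts as the identity.
    eval-at-1 : ∀ n → 1 ≤ n → eval R (poly n) 1# ≈ fromℕ R (size n)
    eval-at-1 n 1≤n = begin
      eval R (poly n) 1#                          ≈⟨ eval-cong (poly n) (≈-sym (proj₁ (prim n 1≤n))) ⟩
      eval R (poly n) (pow R (ω n) n)             ≈⟨ sieving n 1≤n n 1≤n ≤-refl ⟩
      fromℕ R (fixCount (size n) (iter (act n) n)) ≡⟨ cong (fromℕ R) (fixCount-identity _ _ (actOrder n 1≤n)) ⟩
      fromℕ R (size n)                            ∎

    -- In a Lyndon-like family, g fixes exactly |X_1| points of every X_n: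
    -- the condition with m = n reads f_1(1) = f_n(ω_n).
    lyndon-fixCount : LyndonLike R F → ∀ n → 1 ≤ n →
                      fromℕ R (size 1) ≈ fromℕ R (fixCount (size n) (act n))
    lyndon-fixCount lyndon n 1≤n = begin
      fromℕ R (size 1)                            ≈⟨ ≈-sym (eval-at-1 1 (s≤s z≤n)) ⟩
      eval R (poly 1) 1#                          ≈⟨ lyndon n n 1≤n ∣-refl ⟩
      eval R (poly n) (pow R (ω n) 1)             ≈⟨ sieving n 1≤n 1 (s≤s z≤n) 1≤n ⟩
      fromℕ R (fixCount (size n) (iter (act n) 1)) ∎

lemma7p3 : ∀ {c ℓ} (R : CommutativeRing c ℓ) → IsChar0Domain R →
    (ω : ℕ → CommutativeRing.Carrier R) →
    (∀ n → 1 ≤ n → IsPrimitiveRoot R n (ω n)) →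
    ¬ (Σ (CSPFamily R ω) λ F →
    LyndonLike R F × (∀ n → 1 ≤ n → CSPFamily.size F n ≡ catalan n))
lemma7p3 R dom ω prim (F , lyndon , catalan-size) =
  involution-fixCount≢1 (size 2) (act 2) (actOrder 2 1≤2) (catalan-size 2 1≤2) one-fixed-point
  where
    open CSPFamily F
    1≤2 : 1 ≤ 2
    1≤2 = s≤s z≤n
    one-fixed-point : fixCount (size 2) (act 2) ≡ 1
    one-fixed-point = begin
      fixCount (size 2) (act 2) ≡⟨ sym (fromℕ-injective R dom _ _ (lyndon-fixCount R prim F lyndon 2 1≤2)) ⟩
      size 1                    ≡⟨ catalan-size 1 (s≤s z≤n) ⟩
      catalan 1                 ∎
      where open ≡-Reasoning
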